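{- Let $\mathcal{T}_1$ and $\mathcal{T}_2$ be tangles in a connectivity system $K=(E,\lambda)$, and let $(X_1,X_2)$ be a minimum-order distinguishing separation for $\mathcal{T}_1$ and $\mathcal{T}_2$ with $X_1\in\mathcal{T}_1$ and $X_2\in\mathcal{T}_2$. If $(R,G)$ is a partition of $X_2$, then $\lambda(R)\ge\lambda(X_2)$ or $\lambda(G)\ge\lambda(X_2)$.
   Context: A connectivity system is a pair $(E,\lambda)$ with $E$ finite and $\lambda$ an integer-valued, symmetric ($\lambda(X)=\lambda(E-X)$) and submodular ($\lambda(X)+\lambda(Y)\ge\lambda(X\cup Y)+\lambda(X\cap Y)$) function on subsets of $E$. A tangle of order $k$ is a collection $\mathcal{T}$ of subsets of $E$ with: (T1) $\lambda(A)<k$ for $A\in\mathcal{T}$; (T2) if $\lambda(A)\le k-1$ then $A\in\mathcal{T}$ or $E-A\in\mathcal{T}$; (T3) no $A,B,C\in\mathcal{T}$ (not necessarily distinct) have $A\cup B\cup C=E$; (T4) $E-\{e\}\notin\mathcal{T}$ for $e\in E$. A distinguishing separation for $\mathcal{T}_1,\mathcal{T}_2$ is a partition $(X_1,X_2)$ of $E$ with $X_1\in\mathcal{T}_1$, $X_2\in\mathcal{T}_2$; its order is $\lambda(X_1)=\lambda(X_2)$, and it is minimum-order if no distinguishing separation for the pair has smaller order. -}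

module Defs where

open import Data.Nat using (ℕ)
open import Data.Integer using (ℤ; _+_; _≤_; _<_; _-_; +_)
open import Data.Fin using (Fin)
open import Data.Fin.Subset using (Subset; _∪_; _∩_; ∁; ⁅_⁆; ⊤)
open import Data.Product using (_×_; Σ; _,_)
open import Data.Sum using (_⊎_)
open import Relation.Nullary using (¬_)
open import Relation.Binary.PropositionalEquality using (_≡_)

record ConnectivitySystem (n : ℕ) : Set where
  field
    λ' : Subset n → ℤ
    symmetric : ∀ X → λ' X ≡ λ' (∁ X)
    submodular : ∀ X Y → λ' (X ∪ Y) + λ' (X ∩ Y) ≤ λ' X + λ' Y

open ConnectivitySystem public

record IsTangle {n : ℕ} (K : ConnectivitySystem n) (k : ℤ) (𝒯 : Subset n → Set) : Set where
  field
    T1 : ∀ A → 𝒯 A → λ' K A < k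
    T2 : ∀ A → λ' K A ≤ k - + 1 → 𝒯 A ⊎ 𝒯 (∁ A)
    T3 : ∀ A B C → 𝒯 A → 𝒯 B → 𝒯 C → ¬ (A ∪ B ∪ C ≡ ⊤)
    T4 : ∀ e → ¬ 𝒯 (∁ ⁅ e ⁆)

Tangle : {n : ℕ} → ConnectivitySystem n → Set₁
Tangle {n} K = Σ ℤ λ k → Σ (Subset n → Set) λ 𝒯 → IsTangle K k 𝒯

collection : {n : ℕ} {K : ConnectivitySystem n} → Tangle K → Subset n → Set
collection (k , 𝒯 , _) = 𝒯

-- Distinguishing separation (X₁, E - X₁) for 𝒯₁, 𝒯₂, represented by X₁.
Distinguishes : {n : ℕ} → (𝒯₁ 𝒯₂ : Subset n → Set) → Subset n → Set
Distinguishes 𝒯₁ 𝒯₂ X₁ = 𝒯₁ X₁ × 𝒯₂ (∁ X₁)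

MinDistinguishing : {n : ℕ} (K : ConnectivitySystem n) → (𝒯₁ 𝒯₂ : Subset n → Set) → Subset n → Set
MinDistinguishing K 𝒯₁ 𝒯₂ X₁ =
  Distinguishes 𝒯₁ 𝒯₂ X₁ × (∀ Y → Distinguishes 𝒯₁ 𝒯₂ Y → λ' K X₁ ≤ λ' K Y)

IsPartitionOf : {n : ℕ} → Subset n → Subset n → Subset n → Set
IsPartitionOf R G X = (R ∩ G ≡ Data.Fin.Subset.⊥) × (R ∪ G ≡ X)

-- Suppose λ(R) and λ(G) are both below λ(X₂). A part P of X₂ of such low order must lie in 𝒯₁:
-- otherwise E − P ∈ 𝒯₁; then P ∈ 𝒯₂ is impossible, since (E − P, P) would be a distinguishing
-- separation of smaller order, and E − P ∈ 𝒯₂ is impossible, since E − P and X₂ ∈ 𝒯₂ cover E.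
-- Hence R, G ∈ 𝒯₁, and together with X₁ ∈ 𝒯₁ they cover E, contradicting (T3) for 𝒯₁.
module Submission where

open import Defs
open import Data.Nat using (ℕ)
open import Data.Integer using (ℤ; _≤_; _<_; _-_; +_; -_)
open import Data.Integer.Properties using (<-trans; <-≤-trans; <-irrefl; ≰⇒>; i<j⇒i≤pred[j]; +-comm; _≤?_)
open import Data.Fin.Subset using (Subset; ∁; _∪_; ⊤)
open import Data.Fin.Subset.Properties using (∪-assoc; ∪-comm; ∪-idem; ∪-inverseˡ; ∪-zeroˡ; p∪∁p≡⊤)
open import Data.Vec.Properties using (map-∘; map-cong; map-id)
open import Data.Bool.Properties using (not-involutive)
open import Data.Sum using (_⊎_; inj₁; inj₂)
open import Data.Product using (_,_; proj₁; proj₂)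
open import Data.Empty using (⊥-elim)
open import Relation.Nullary using (yes; no; ¬_)
open import Relation.Binary.PropositionalEquality using (_≡_; refl; sym; trans; cong; subst; subst₂; module ≡-Reasoning)

∁-involutive : ∀ {n} (p : Subset n) → ∁ (∁ p) ≡ p
∁-involutive p = trans (sym (map-∘ _ _ p)) (trans (map-cong not-involutive p) (map-id p))

∁p∪[p∪q]≡⊤ : ∀ {n} (p q : Subset n) → ∁ p ∪ (p ∪ q) ≡ ⊤
∁p∪[p∪q]≡⊤ p q = begin
  ∁ p ∪ (p ∪ q)  ≡⟨ sym (∪-assoc (∁ p) p q) ⟩
  (∁ p ∪ p) ∪ q  ≡⟨ cong (_∪ q) (∪-inverseˡ p) ⟩
  ⊤ ∪ q          ≡⟨ ∪-zeroˡ q ⟩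
  ⊤              ∎
  where open ≡-Reasoning

i<j⇒i≤j-1 : ∀ {i j : ℤ} → i < j → i ≤ j - + 1
i<j⇒i≤j-1 {i} {j} i<j = subst (i ≤_) (+-comm (- + 1) j) (i<j⇒i≤pred[j] i<j)

module _ {n : ℕ} {K : ConnectivitySystem n} {k : ℤ} {𝒯 : Subset n → Set} (t : IsTangle K k 𝒯) where
  open IsTangle t

  λ<k⇒∈⊎∁∈ : ∀ A → λ' K A < k → 𝒯 A ⊎ 𝒯 (∁ A)
  λ<k⇒∈⊎∁∈ A λA<k = T2 A (i<j⇒i≤j-1 λA<k)

  ∪∈⇒∁∉ : ∀ P Q → 𝒯 (P ∪ Q) → ¬ 𝒯 (∁ P)
  ∪∈⇒∁∉ P Q P∪Q∈ ∁P∈ = T3 (∁ P) (P ∪ Q) (P ∪ Q) ∁P∈ P∪Q∈ P∪Q∈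
    (trans (cong (∁ P ∪_) (∪-idem (P ∪ Q))) (∁p∪[p∪q]≡⊤ P Q))

module _ {n : ℕ} {K : ConnectivitySystem n} {k₁ k₂ : ℤ} {𝒯₁ 𝒯₂ : Subset n → Set}
         (t₁ : IsTangle K k₁ 𝒯₁) (t₂ : IsTangle K k₂ 𝒯₂) {X₁ : Subset n}
         (min : MinDistinguishing K 𝒯₁ 𝒯₂ X₁) where
  open IsTangle

  private
    X₁∈𝒯₁ : 𝒯₁ X₁
    X₁∈𝒯₁ = proj₁ (proj₁ min)

    X₂∈𝒯₂ : 𝒯₂ (∁ X₁)
    X₂∈𝒯₂ = proj₂ (proj₁ min)

    λX₂<k₁ : λ' K (∁ X₁) < k₁
    λX₂<k₁ = subst (_< k₁) (symmetric K X₁) (T1 t₁ X₁ X₁∈𝒯₁)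

    -- (E − P, P) would distinguish the tangles with order λ(P) < λ(X₂) = λ(X₁).
    ∁∈𝒯₁⇒λX₂≤λ : ∀ P → 𝒯₁ (∁ P) → 𝒯₂ P → λ' K (∁ X₁) ≤ λ' K P
    ∁∈𝒯₁⇒λX₂≤λ P ∁P∈𝒯₁ P∈𝒯₂ = subst₂ _≤_ (symmetric K X₁) (sym (symmetric K P))
      (proj₂ min (∁ P) (∁P∈𝒯₁ , subst 𝒯₂ (sym (∁-involutive P)) P∈𝒯₂))

  low-order-part-∈𝒯₁ : ∀ P Q → ∁ X₁ ≡ P ∪ Q → λ' K P < λ' K (∁ X₁) → 𝒯₁ P
  low-order-part-∈𝒯₁ P Q X₂≡P∪Q λP<λX₂ with λ<k⇒∈⊎∁∈ t₁ P (<-trans λP<λX₂ λX₂<k₁)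
  ... | inj₁ P∈𝒯₁ = P∈𝒯₁
  ... | inj₂ ∁P∈𝒯₁ with λ<k⇒∈⊎∁∈ t₂ P (<-trans λP<λX₂ (T1 t₂ (∁ X₁) X₂∈𝒯₂))
  ...   | inj₁ P∈𝒯₂ = ⊥-elim (<-irrefl refl (<-≤-trans λP<λX₂ (∁∈𝒯₁⇒λX₂≤λ P ∁P∈𝒯₁ P∈𝒯₂)))
  ...   | inj₂ ∁P∈𝒯₂ = ⊥-elim (∪∈⇒∁∉ t₂ P Q (subst 𝒯₂ X₂≡P∪Q X₂∈𝒯₂) ∁P∈𝒯₂)

lemma4p1 : {n : ℕ} (K : ConnectivitySystem n) (𝒯₁ 𝒯₂ : Tangle K) (X₁ X₂ : Subset n) →
    X₂ ≡ ∁ X₁ →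
    MinDistinguishing K (collection 𝒯₁) (collection 𝒯₂) X₁ →
    (R G : Subset n) → IsPartitionOf R G X₂ →
    λ' K X₂ ≤ λ' K R ⊎ λ' K X₂ ≤ λ' K G
lemma4p1 K 𝒯₁@(_ , _ , t₁) (_ , _ , t₂) X₁ _ refl min@((X₁∈𝒯₁ , _) , _) R G (_ , R∪G≡X₂)
  with λ' K (∁ X₁) ≤? λ' K R | λ' K (∁ X₁) ≤? λ' K G
... | yes λX₂≤λR | _           = inj₁ λX₂≤λR
... | no _       | yes λX₂≤λG = inj₂ λX₂≤λG
... | no λX₂≰λR  | no λX₂≰λG  = ⊥-elim (IsTangle.T3 t₁ X₁ R G X₁∈𝒯₁ R∈𝒯₁ G∈𝒯₁ X₁∪R∪G≡⊤)
  where
  R∈𝒯₁ : collection 𝒯₁ R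
  R∈𝒯₁ = low-order-part-∈𝒯₁ t₁ t₂ min R G (sym R∪G≡X₂) (≰⇒> λX₂≰λR)
  G∈𝒯₁ : collection 𝒯₁ G
  G∈𝒯₁ = low-order-part-∈𝒯₁ t₁ t₂ min G R (trans (sym R∪G≡X₂) (∪-comm R G)) (≰⇒> λX₂≰λG)
  X₁∪R∪G≡⊤ : X₁ ∪ R ∪ G ≡ ⊤
  X₁∪R∪G≡⊤ = trans (cong (X₁ ∪_) R∪G≡X₂) (p∪∁p≡⊤ X₁)
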